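{- For every positive integer $n$ and every $(3,n)$-parking function $\pi$ with $\mathrm{pides}(\pi)=2^a1^b$, $\mathrm{area}(\pi)=\mathrm{area}(\mathbb{S}(\pi))$.
   Context: A $(3,n)$-parking function $\pi$ is a north/east lattice path from $(0,0)$ to $(3,n)$ weakly above $y=\frac n3x$ whose $n$ north steps are labeled bijectively by $1,\dots,n$ (cars, in the cells just right of the north steps), increasing upward in each column. $\mathrm{area}$ of a $(3,N)$-parking function is the number of full unit cells lying between its path and the line $y=\frac N3x$. With $d=\gcd(3,n)$, the cell with lower-left corner $(x,y)$ has rank $3y-nx+\lfloor xd/3\rfloor$. $\mathrm{ides}(\pi)=\{i:\mathrm{rank}(i)<\mathrm{rank}(i+1)\}=\{i_1<\dots<i_r\}$, $\mathrm{pides}(\pi)=(i_1,i_2-i_1,\dots,n-i_r)$; $2^a1^b$ is the composition with $a$ parts $2$ followed by $b$ parts $1$ (so $n=2a+b$). The columns are $\ell,c,r$ (left to right). For $i=1,\dots,a$ the cars $2i-1,2i$ ("pair $i$") lie in two distinct columns, with placement type $L$ if these are $\{\ell,c\}$, $R$ if $\{c,r\}$, $C$ if $\{\ell,r\}$; the singleton car $2a+s$ ($s=1,\dots,b$) has type $L$, $C$, $R$ if it is in column $\ell$, $c$, $r$. Let $p_1,\dots,p_a$ be the pair types and $p_{a+1},\dots,p_{a+b}$ the singleton types. The switch map $\mathbb{S}$: take $b$ pairs $(2i-1,2i)$, $i\le b$, and $a$ singletons $2b+1,\dots,2b+a$, as objects $1,\dots,a+b$ (pairs first); object $j$ gets type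 $p_{a+b+1-j}$; a pair of type $L$/$R$/$C$ puts one car in each of columns $\{\ell,c\}$/$\{c,r\}$/$\{\ell,r\}$, a singleton of type $L$/$C$/$R$ goes to column $\ell$/$c$/$r$. $\mathbb{S}(\pi)$ is the resulting labeling of the $3\times(a+2b)$ grid with column heights equal to the numbers of cars assigned and cars increasing upward in each column; it is a $(3,a+2b)$-parking function. -}

module Defs where

open import Data.Nat using (ℕ; zero; suc; _+_; _*_; _∸_; _≤_; _<_; _/_; _≤?_; _<?_)
open import Data.Nat.GCD using (gcd)
open import Data.Fin using (Fin; toℕ; fromℕ<)
open import Data.Fin.Properties using (_≟_)
open import Data.List using (List; []; _∷_; filter; length; allFin; upTo; map; replicate; _++_)
open import Data.Integer as ℤ using (ℤ; +_)
import Data.Integer.Properties as ℤP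
open import Data.Product using (_×_)
open import Relation.Nullary.Decidable using (yes; no; _×-dec_)

-- A labeled (3,n)-lattice path with cars increasing upward in each column
-- is determined by the column of each car.  Car k (1-based) is the Fin
-- index k-1.  Columns: 0 = ℓ, 1 = c, 2 = r.

Labeling : ℕ → Set
Labeling n = Fin n → Fin 3

height : ∀ {n} → Labeling n → Fin 3 → ℕ
height {n} col x = length (filter (λ i → col i ≟ x) (allFin n))

base : ∀ {n} → Labeling n → ℕ → ℕ
base col zero = 0
base col (suc zero) = height col Data.Fin.zero
base col (suc (suc _)) = height col Data.Fin.zero + height col (Data.Fin.suc Data.Fin.zero)

topFull : ∀ {n} → Labeling n → Fin 3 → ℕ
topFull {n} col Data.Fin.zero = height col Data.Fin.zero
topFull {n} col (Data.Fin.suc Data.Fin.zero) =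
  height col Data.Fin.zero + height col (Data.Fin.suc Data.Fin.zero)
topFull {n} col (Data.Fin.suc (Data.Fin.suc _)) =
  height col Data.Fin.zero + height col (Data.Fin.suc Data.Fin.zero)
    + height col (Data.Fin.suc (Data.Fin.suc Data.Fin.zero))

-- (3,n)-parking function: the path stays weakly above y = (n/3) x,
-- i.e. at the east step leaving column x the path height t satisfies
-- t ≥ n (x+1)/3, for x = 0, 1 (for x = 2 it is n ≥ n).
IsParkingFunction : (n : ℕ) → Labeling n → Set
IsParkingFunction n col =
  (n ≤ 3 * topFull col Data.Fin.zero) ×
  (2 * n ≤ 3 * topFull col (Data.Fin.suc Data.Fin.zero))

-- area: number of full unit cells [x,x+1]×[y,y+1] lying under the path
-- (y + 1 ≤ top of column x) and above the line y = (N/3) x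
-- (the whole cell is above the line iff N (x+1) ≤ 3 y).
areaCol : ℕ → ℕ → ℕ → ℕ
areaCol N x t = length (filter (λ y → N * (x + 1) ≤? 3 * y) (upTo t))

area : (N : ℕ) → Labeling N → ℕ
area N col =
    areaCol N 0 (topFull col Data.Fin.zero)
  + areaCol N 1 (topFull col (Data.Fin.suc Data.Fin.zero))
  + areaCol N 2 (topFull col (Data.Fin.suc (Data.Fin.suc Data.Fin.zero)))

row : ∀ {n} → Labeling n → Fin n → ℕ
row {n} col i =
  base col (toℕ (col i)) +
  length (filter (λ j → (toℕ j <? toℕ i) ×-dec (col j ≟ col i)) (allFin n))

cellRank : ℕ → ℕ → ℕ → ℤ
cellRank n x y = (+ (3 * y) ℤ.- + (n * x)) ℤ.+ + ((x * gcd 3 n) / 3)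

rank : ∀ {n} → Labeling n → Fin n → ℤ
rank {n} col i = cellRank n (toℕ (col i)) (row col i)

-- rank of the car with 0-based index k (junk value 0 if k ≥ n)
rankAt : ∀ {n} → Labeling n → ℕ → ℤ
rankAt {n} col k with k <? n
... | yes p = rank col (fromℕ< p)
... | no _  = + 0

ides : ∀ {n} → Labeling n → List ℕ
ides {n} col =
  map suc (filter (λ k → rankAt col k ℤP.<? rankAt col (suc k)) (upTo (n ∸ 1)))

diffs : ℕ → ℕ → List ℕ → List ℕ
diffs n prev [] = (n ∸ prev) ∷ []
diffs n prev (i ∷ is) = (i ∸ prev) ∷ diffs n i is

pides : ∀ {n} → Labeling n → List ℕ
pides {n} col = diffs n 0 (ides col)

comp21 : ℕ → ℕ → List ℕ
comp21 a b = replicate a 2 ++ replicate b 1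

data PType : Set where
  L C R : PType

-- column of the car with 1-based label k (junk value ℓ if out of range)
colOf : ∀ {n} → Labeling n → ℕ → Fin 3
colOf {n} col zero = Data.Fin.zero
colOf {n} col (suc k) with k <? n
... | yes p = col (fromℕ< p)
... | no _  = Data.Fin.zero

-- type of a pair occupying columns x, y: {ℓ,c} ↦ L, {c,r} ↦ R, {ℓ,r} ↦ C.
-- (x = y never happens under the hypothesis pides = 2^a1^b; junk value L.)
pairType : Fin 3 → Fin 3 → PType
pairType x y with toℕ x | toℕ y
... | 0 | 1 = L
... | 1 | 0 = L
... | 1 | 2 = R
... | 2 | 1 = R
... | 0 | 2 = C
... | 2 | 0 = C
... | _ | _ = L

singleType : Fin 3 → PType
singleType x with toℕ x
... | 0 = L
... | 1 = C
... | _ = R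

-- p_m for m = 1,…,a+b  (pairs 1..a, then singletons a+1..a+b)
ptype : ∀ {n} → Labeling n → ℕ → ℕ → PType
ptype col a m with m ≤? a
... | yes _ = pairType (colOf col (2 * m ∸ 1)) (colOf col (2 * m))
... | no _  = singleType (colOf col (2 * a + (m ∸ a)))

ℓ' c' r' : Fin 3
ℓ' = Data.Fin.zero
c' = Data.Fin.suc Data.Fin.zero
r' = Data.Fin.suc (Data.Fin.suc Data.Fin.zero)

-- column of the first (smaller) / second (larger) car of a pair of type t.
-- Convention: the smaller car goes in the left of the two columns
-- (irrelevant for column heights, hence for area).
pairFirst pairSecond : PType → Fin 3
pairFirst L = ℓ'
pairFirst R = c'
pairFirst C = ℓ'
pairSecond L = c'
pairSecond R = r'
pairSecond C = r'

singleCol : PType → Fin 3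
singleCol L = ℓ'
singleCol C = c'
singleCol R = r'

-- New car with 0-based index k:
--  k < 2b : belongs to pair object j = ⌊k/2⌋ + 1 (cars 2j-1, 2j),
--  k ≥ 2b : singleton object j = b + (k - 2b) + 1 (car 2b + (j - b)),
-- and object j has type p_{a+b+1-j}.
switch : ∀ {n} → Labeling n → (a b : ℕ) → Labeling (a + 2 * b)
switch col a b k with toℕ k <? 2 * b
... | yes _ with toℕ k Data.Nat.% 2
...   | 0 = pairFirst  (ptype col a (a + b + 1 ∸ (toℕ k / 2 + 1)))
...   | _ = pairSecond (ptype col a (a + b + 1 ∸ (toℕ k / 2 + 1)))
switch col a b k | no _ =
  singleCol (ptype col a (a + b + 1 ∸ (b + (toℕ k ∸ 2 * b) + 1)))

-- Only the column heights matter for the area.  Under pides π = 2^a1^b the two cars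
-- of every pair lie in different columns (two consecutive cars in one column would put
-- the first of them into ides), so every column height of π is a sum over the a pair
-- types and the b singleton types, and the heights of 𝕊(π) are the same sums with the
-- roles of the two type sequences exchanged.  Type by type one checks that the middle
-- column of π ends exactly a cells above the left column of 𝕊(π), and the middle column
-- of 𝕊(π) exactly b cells above the left column of π.  The number of full cells between
-- the line y = Nx/3 and the top t of column x depends only on 3t − N(x+1), so these two
-- relations make the left and middle columns of π and 𝕊(π) contribute crosswise equal
-- areas, while the right column contributes nothing to either.

module Submission where

open import Defs
open import Level using (0ℓ)
open import Data.Nat using (ℕ; zero; suc; _+_; _*_; _∸_; _≤_; _<_; _/_; _%_; z≤n; s≤s; NonZero)
open import Data.Nat.Properties
open import Data.Nat.DivMod using (+-distrib-/-∣ʳ; m<n⇒m/n≡0; m*n/n≡m; [m+kn]%n≡m%n; m<n⇒m%n≡m)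
open import Data.Nat.Divisibility using (m∣m*n)
open import Data.Nat.GCD using (gcd)
open import Data.Nat.Tactic.RingSolver using (solve-∀)
open import Data.Fin using (Fin; toℕ; fromℕ<) renaming (zero to fz; suc to fs)
import Data.Fin.Properties as Fin
import Data.Integer as ℤ
import Data.Integer.Properties as ℤP
open import Data.Bool using (if_then_else_)
open import Data.List using ([]; _∷_; filter; length; upTo; tabulate; replicate; _++_)
open import Data.List.Properties using (length-++; filter-++; upTo-∷ʳ; filter-accept; filter-reject; filter-none; ∷-injective; ∷-injectiveˡ; ∷-injectiveʳ)
open import Data.List.Membership.Propositional using (_∈_; _∉_)
open import Data.List.Membership.Propositional.Properties using (∈-upTo⁺; ∈-upTo⁻; ∈-filter⁺; ∈-filter⁻; ∈-allFin; ∈-map⁺)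
open import Data.List.Relation.Unary.All as All using (All; []; _∷_)
open import Data.List.Relation.Unary.Any using (here; there)
open import Data.List.Relation.Binary.Sublist.Heterogeneous using (Sublist)
open import Data.List.Relation.Binary.Sublist.Heterogeneous.Properties using (⊆-filter-Sublist; length-mono-≤; toPointwise; fromPointwise)
open import Data.List.Relation.Binary.Pointwise using (Pointwise-≡⇒≡; ≡⇒Pointwise-≡)
open import Data.Product using (_×_; _,_; proj₂)
open import Function using (_∘_)
open import Relation.Binary.PropositionalEquality
open import Relation.Nullary using (¬_; yes; no; does)
open import Relation.Nullary.Decidable using (dec-true; dec-false; _×-dec_)
open import Relation.Nullary.Negation using (contradiction)
open import Relation.Unary using (Pred; Decidable; _⊆_)

sumFrom : (ℕ → ℕ) → ℕ → ℕ → ℕ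
sumFrom f lo zero = 0
sumFrom f lo (suc len) = f lo + sumFrom f (suc lo) len

sumFrom-offset : ∀ f k len → sumFrom f k len ≡ sumFrom (λ m → f (k + m)) 0 len
sumFrom-offset f k len = trans (cong (λ lo → sumFrom f lo len) (sym (+-identityʳ k))) (shifted 0 len)
  where
  shifted : ∀ lo len → sumFrom f (k + lo) len ≡ sumFrom (λ m → f (k + m)) lo len
  shifted lo zero = refl
  shifted lo (suc len) = cong (f (k + lo) +_)
    (trans (cong (λ m → sumFrom f m len) (sym (+-suc k lo))) (shifted (suc lo) len))

module _ (f : ℕ → ℕ) where

  sumFrom-split : ∀ lo l₁ l₂ → sumFrom f lo (l₁ + l₂) ≡ sumFrom f lo l₁ + sumFrom f (lo + l₁) l₂
  sumFrom-split lo zero l₂ = cong (λ m → sumFrom f m l₂) (sym (+-identityʳ lo))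
  sumFrom-split lo (suc l₁) l₂ = begin
    f lo + sumFrom f (suc lo) (l₁ + l₂)
      ≡⟨ cong (f lo +_) (sumFrom-split (suc lo) l₁ l₂) ⟩
    f lo + (sumFrom f (suc lo) l₁ + sumFrom f (suc lo + l₁) l₂)
      ≡⟨ sym (+-assoc (f lo) _ _) ⟩
    f lo + sumFrom f (suc lo) l₁ + sumFrom f (suc lo + l₁) l₂
      ≡⟨ cong (λ m → f lo + sumFrom f (suc lo) l₁ + sumFrom f m l₂) (sym (+-suc lo l₁)) ⟩
    f lo + sumFrom f (suc lo) l₁ + sumFrom f (lo + suc l₁) l₂ ∎
    where open ≡-Reasoning

  sumFrom-snoc : ∀ lo len → sumFrom f lo (suc len) ≡ sumFrom f lo len + f (lo + len)
  sumFrom-snoc lo len = trans (cong (sumFrom f lo) (+-comm 1 len))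
    (trans (sumFrom-split lo len 1) (cong (sumFrom f lo len +_) (+-identityʳ (f (lo + len)))))

  sumFrom-pairs : ∀ lo len →
    sumFrom f (2 * lo) (2 * len) ≡ sumFrom (λ j → f (2 * j) + f (suc (2 * j))) lo len
  sumFrom-pairs lo zero = refl
  sumFrom-pairs lo (suc len) = begin
    sumFrom f (2 * lo) (2 * suc len)
      ≡⟨ cong (sumFrom f (2 * lo)) (*-suc 2 len) ⟩
    f (2 * lo) + (f (suc (2 * lo)) + sumFrom f (2 + 2 * lo) (2 * len))
      ≡⟨ sym (+-assoc (f (2 * lo)) _ _) ⟩
    f (2 * lo) + f (suc (2 * lo)) + sumFrom f (2 + 2 * lo) (2 * len)
      ≡⟨ cong (λ m → f (2 * lo) + f (suc (2 * lo)) + sumFrom f m (2 * len)) (sym (*-suc 2 lo)) ⟩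
    f (2 * lo) + f (suc (2 * lo)) + sumFrom f (2 * suc lo) (2 * len)
      ≡⟨ cong (f (2 * lo) + f (suc (2 * lo)) +_) (sumFrom-pairs (suc lo) len) ⟩
    sumFrom (λ j → f (2 * j) + f (suc (2 * j))) lo (suc len) ∎
    where open ≡-Reasoning

  sumFrom-reverse : ∀ lo len → sumFrom (λ j → f (lo + len ∸ j)) 0 len ≡ sumFrom f (suc lo) len
  sumFrom-reverse lo zero = refl
  sumFrom-reverse lo (suc len) = begin
    f (lo + suc len) + sumFrom (λ j → f (lo + suc len ∸ j)) 1 len
      ≡⟨ cong (f (lo + suc len) +_) (sumFrom-offset (λ j → f (lo + suc len ∸ j)) 1 len) ⟩
    f (lo + suc len) + sumFrom (λ j → f (lo + suc len ∸ suc j)) 0 len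
      ≡⟨ cong (λ m → f m + sumFrom (λ j → f (m ∸ suc j)) 0 len) (+-suc lo len) ⟩
    f (suc lo + len) + sumFrom (λ j → f (lo + len ∸ j)) 0 len
      ≡⟨ cong (f (suc lo + len) +_) (sumFrom-reverse lo len) ⟩
    f (suc lo + len) + sumFrom f (suc lo) len
      ≡⟨ +-comm (f (suc lo + len)) _ ⟩
    sumFrom f (suc lo) len + f (suc lo + len)
      ≡⟨ sym (sumFrom-snoc (suc lo) len) ⟩
    sumFrom f (suc lo) (suc len) ∎
    where open ≡-Reasoning

sumFrom-cong : ∀ {f g} lo len → (∀ m → m < lo + len → f m ≡ g m) → sumFrom f lo len ≡ sumFrom g lo len
sumFrom-cong lo zero eq = refl
sumFrom-cong lo (suc len) eq = cong₂ _+_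
  (eq lo (m<m+n lo (s≤s z≤n)))
  (sumFrom-cong (suc lo) len (λ m m< → eq m (subst (m <_) (sym (+-suc lo len)) m<)))

sumFrom-+ : ∀ f g lo len → sumFrom (λ m → f m + g m) lo len ≡ sumFrom f lo len + sumFrom g lo len
sumFrom-+ f g lo zero = refl
sumFrom-+ f g lo (suc len) =
  trans (cong (f lo + g lo +_) (sumFrom-+ f g (suc lo) len)) (+-interchange (f lo) (g lo) _ _)
  where
  +-interchange : ∀ p q r s → p + q + (r + s) ≡ p + r + (q + s)
  +-interchange = solve-∀

sumFrom-suc : ∀ f lo len → sumFrom (λ m → suc (f m)) lo len ≡ sumFrom f lo len + len
sumFrom-suc f lo zero = refl
sumFrom-suc f lo (suc len) = trans (cong (suc (f lo) +_) (sumFrom-suc f (suc lo) len))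
  (trans (cong suc (sym (+-assoc (f lo) _ len))) (sym (+-suc (f lo + sumFrom f (suc lo) len) len)))

sumFrom-ones : ∀ lo len → sumFrom (λ _ → 1) lo len ≡ len
sumFrom-ones lo zero = refl
sumFrom-ones lo (suc len) = cong suc (sumFrom-ones (suc lo) len)

≤-transfer : ∀ {A A′ u u′} → u + A′ ≡ u′ + A → A ≤ u → A′ ≤ u′
≤-transfer {A} {A′} {u} {u′} eq A≤u = +-cancelˡ-≤ u _ _ (begin
  u + A′ ≡⟨ eq ⟩
  u′ + A ≤⟨ +-monoʳ-≤ u′ A≤u ⟩
  u′ + u ≡⟨ +-comm u′ u ⟩
  u + u′ ∎)
  where open ≤-Reasoning

*-suc-cancel : ∀ k {M M′} t t′ → k * suc t + M′ ≡ k * suc t′ + M → k * t + M′ ≡ k * t′ + M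
*-suc-cancel k {M} {M′} t t′ eq = +-cancelˡ-≡ k _ _ (begin
  k + (k * t + M′) ≡⟨ +-assoc k _ M′ ⟨
  k + k * t + M′   ≡⟨ cong (_+ M′) (*-suc k t) ⟨
  k * suc t + M′   ≡⟨ eq ⟩
  k * suc t′ + M   ≡⟨ cong (_+ M) (*-suc k t′) ⟩
  k + k * t′ + M   ≡⟨ +-assoc k _ M ⟩
  k + (k * t′ + M) ∎)
  where open ≡-Reasoning

-- areaCol N x t is countAbove 3 (N * (x + 1)) t.
countAbove : ℕ → ℕ → ℕ → ℕ
countAbove k M t = length (filter (λ y → M ≤? k * y) (upTo t))

module _ (k : ℕ) .{{_ : NonZero k}} where

  countAbove-none : ∀ {M} t → k * t ≤ M → countAbove k M t ≡ 0
  countAbove-none {M} t kt≤M = cong length (filter-none (λ y → M ≤? k * y) (All.tabulate below))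
    where
    below : ∀ {y} → y ∈ upTo t → ¬ M ≤ k * y
    below y∈ M≤ky = <⇒≱ (≤-trans (*-monoʳ-< k (∈-upTo⁻ y∈)) kt≤M) M≤ky

  countAbove-suc : ∀ M t → countAbove k M (suc t) ≡ countAbove k M t + length (filter (λ y → M ≤? k * y) (t ∷ []))
  countAbove-suc M t = begin
    length (filter P? (upTo (suc t)))                 ≡⟨ cong (length ∘ filter P?) (sym (upTo-∷ʳ t)) ⟩
    length (filter P? (upTo t ++ t ∷ []))             ≡⟨ cong length (filter-++ P? (upTo t) (t ∷ [])) ⟩
    length (filter P? (upTo t) ++ filter P? (t ∷ [])) ≡⟨ length-++ (filter P? (upTo t)) ⟩
    countAbove k M t + length (filter P? (t ∷ []))    ∎
    where
    open ≡-Reasoning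
    P? = λ y → M ≤? k * y

  countAbove-accept : ∀ {M} t → M ≤ k * t → countAbove k M (suc t) ≡ countAbove k M t + 1
  countAbove-accept {M} t M≤kt =
    trans (countAbove-suc M t) (cong (λ l → countAbove k M t + length l) (filter-accept (λ y → M ≤? k * y) M≤kt))

  countAbove-reject : ∀ {M} t → ¬ M ≤ k * t → countAbove k M (suc t) ≡ countAbove k M t + 0
  countAbove-reject {M} t M≰kt =
    trans (countAbove-suc M t) (cong (λ l → countAbove k M t + length l) (filter-reject (λ y → M ≤? k * y) M≰kt))

  countAbove-shift : ∀ {M M′} t t′ → k * t + M′ ≡ k * t′ + M → countAbove k M t ≡ countAbove k M′ t′
  countAbove-shift {M} {M′} zero t′ eq =
    sym (countAbove-none t′ (subst (k * t′ ≤_) (trans (sym eq) (cong (_+ M′) (*-zeroʳ k))) (m≤m+n (k * t′) M)))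
  countAbove-shift (suc t) zero eq = sym (countAbove-shift zero (suc t) (sym eq))
  countAbove-shift {M} {M′} (suc t) (suc t′) eq with M ≤? k * t | *-suc-cancel k t t′ eq
  ... | yes M≤kt | eq′ = begin
    countAbove k M (suc t)    ≡⟨ countAbove-accept t M≤kt ⟩
    countAbove k M t + 1      ≡⟨ cong (_+ 1) (countAbove-shift t t′ eq′) ⟩
    countAbove k M′ t′ + 1    ≡⟨ countAbove-accept t′ (≤-transfer eq′ M≤kt) ⟨
    countAbove k M′ (suc t′)  ∎
    where open ≡-Reasoning
  ... | no M≰kt | eq′ = begin
    countAbove k M (suc t)    ≡⟨ countAbove-reject t M≰kt ⟩
    countAbove k M t + 0      ≡⟨ cong (_+ 0) (countAbove-shift t t′ eq′) ⟩
    countAbove k M′ t′ + 0    ≡⟨ countAbove-reject t′ (M≰kt ∘ ≤-transfer (sym eq′)) ⟨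
    countAbove k M′ (suc t′)  ∎
    where open ≡-Reasoning

δ : Fin 3 → Fin 3 → ℕ
δ x y = if does (x Fin.≟ y) then 1 else 0

δ-refl : ∀ x → δ x x ≡ 1
δ-refl x rewrite dec-true (x Fin.≟ x) refl = refl

δ-≢ : ∀ {x y} → x ≢ y → δ x y ≡ 0
δ-≢ {x} {y} x≢y rewrite dec-false (x Fin.≟ y) x≢y = refl

δ-partition : ∀ y → δ y ℓ' + δ y c' + δ y r' ≡ 1
δ-partition fz = refl
δ-partition (fs fz) = refl
δ-partition (fs (fs fz)) = refl

colAt : ∀ {n} → Labeling n → ℕ → Fin 3
colAt col k = colOf col (suc k)

colAt-fromℕ< : ∀ {n} (col : Labeling n) {k} (k<n : k < n) → colAt col k ≡ col (fromℕ< k<n)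
colAt-fromℕ< {n} col {k} k<n with k <? n
... | yes k<n′ = cong col (Fin.fromℕ<-cong k k refl k<n′ k<n)
... | no k≮n = contradiction k<n k≮n

height-sumFrom : ∀ {n} (col : Labeling n) (h : ℕ → Fin 3) → (∀ i → h (toℕ i) ≡ col i) →
  ∀ x → height col x ≡ sumFrom (λ k → δ (h k) x) 0 n
height-sumFrom {n} col h h≡col x = go 0 (λ i → i) h≡col
  where
  go : ∀ {m} lo (g : Fin m → Fin n) → (∀ i → h (lo + toℕ i) ≡ col (g i)) →
    length (filter (λ i → col i Fin.≟ x) (tabulate g)) ≡ sumFrom (λ k → δ (h k) x) lo m
  go {zero} lo g e = refl
  go {suc m} lo g e
    with col (g fz) Fin.≟ x
       | trans (cong h (sym (+-identityʳ lo))) (e fz)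
       | go (suc lo) (g ∘ fs) (λ i → trans (cong h (sym (+-suc lo (toℕ i)))) (e (fs i)))
  ... | yes g₀≡x | h-lo | ih = cong₂ _+_ (sym (trans (cong (λ y → δ y x) (trans h-lo g₀≡x)) (δ-refl x))) ih
  ... | no g₀≢x  | h-lo | ih = trans ih (cong (_+ sumFrom (λ k → δ (h k) x) (suc lo) m) (sym (δ-≢ (g₀≢x ∘ trans (sym h-lo)))))

colAt-toℕ : ∀ {n} (col : Labeling n) (i : Fin n) → colAt col (toℕ i) ≡ col i
colAt-toℕ col i = trans (colAt-fromℕ< col (Fin.toℕ<n i)) (cong col (Fin.fromℕ<-toℕ i (Fin.toℕ<n i)))

height-total : ∀ {n} (col : Labeling n) → height col ℓ' + height col c' + height col r' ≡ n
height-total {n} col = begin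
  height col ℓ' + height col c' + height col r'
    ≡⟨ cong₂ _+_ (cong₂ _+_ (count ℓ') (count c')) (count r') ⟩
  Σ (cars ℓ') + Σ (cars c') + Σ (cars r')
    ≡⟨ cong (_+ Σ (cars r')) (sumFrom-+ (cars ℓ') (cars c') 0 n) ⟨
  Σ (λ k → cars ℓ' k + cars c' k) + Σ (cars r')
    ≡⟨ sumFrom-+ (λ k → cars ℓ' k + cars c' k) (cars r') 0 n ⟨
  Σ (λ k → cars ℓ' k + cars c' k + cars r' k)
    ≡⟨ sumFrom-cong 0 n (λ k _ → δ-partition (colAt col k)) ⟩
  Σ (λ _ → 1)
    ≡⟨ sumFrom-ones 0 n ⟩
  n ∎
  where
  open ≡-Reasoning
  Σ : (ℕ → ℕ) → ℕ
  Σ f = sumFrom f 0 n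
  cars : Fin 3 → ℕ → ℕ
  cars x k = δ (colAt col k) x
  count = height-sumFrom col (colAt col) (colAt-toℕ col)

areaCol-shift : ∀ N x t N′ x′ t′ → 3 * t + N′ * (x′ + 1) ≡ 3 * t′ + N * (x + 1) →
  areaCol N x t ≡ areaCol N′ x′ t′
areaCol-shift N x t N′ x′ t′ = countAbove-shift 3 t t′

area-twoColumns : ∀ {n} (col : Labeling n) →
  area n col ≡ areaCol n 0 (topFull col ℓ') + areaCol n 1 (topFull col c')
area-twoColumns {n} col =
  trans (cong (left+middle +_) (trans (cong (areaCol n 2) (height-total col)) right-empty)) (+-identityʳ left+middle)
  where
  left+middle = areaCol n 0 (topFull col ℓ') + areaCol n 1 (topFull col c')
  right-empty : areaCol n 2 n ≡ 0
  right-empty = countAbove-none 3 n (≤-reflexive (*-comm 3 n))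

length-filter-< : ∀ {A : Set} {P Q : Pred A 0ℓ} (P? : Decidable P) (Q? : Decidable Q) →
  P ⊆ Q → ∀ {x xs} → x ∈ xs → Q x → ¬ P x →
  length (filter P? xs) < length (filter Q? xs)
length-filter-< P? Q? P⊆Q {x} {xs} x∈xs Qx ¬Px =
  ≤∧≢⇒< (length-mono-≤ P-sub-Q) λ eq → ¬Px (proj₂ (∈-filter⁻ P? {xs = xs}
    (subst (x ∈_) (sym (Pointwise-≡⇒≡ (toPointwise eq P-sub-Q))) (∈-filter⁺ Q? x∈xs Qx))))
  where
  P-sub-Q : Sublist _≡_ (filter P? xs) (filter Q? xs)
  P-sub-Q = ⊆-filter-Sublist P? Q? (λ { refl → P⊆Q }) (fromPointwise (≡⇒Pointwise-≡ {x = xs} refl))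

row-< : ∀ {n} (col : Labeling n) {i i′ : Fin n} → col i ≡ col i′ → toℕ i < toℕ i′ → row col i < row col i′
row-< {n} col {i} {i′} same i<i′ rewrite same =
  +-monoʳ-< (base col (toℕ (col i′)))
    (length-filter-< (λ j → (toℕ j <? toℕ i) ×-dec (col j Fin.≟ col i′))
                     (λ j → (toℕ j <? toℕ i′) ×-dec (col j Fin.≟ col i′))
                     (λ (j<i , e) → <-trans j<i i<i′ , e) (∈-allFin i) (i<i′ , same) (λ (i<i , _) → n≮n _ i<i))

cellRank-monoʳ-< : ∀ n x {y y′} → y < y′ → cellRank n x y ℤ.< cellRank n x y′
cellRank-monoʳ-< n x y<y′ =
  ℤP.+-monoˡ-< (ℤ.+ (x * gcd 3 n / 3)) (ℤP.+-monoˡ-< (ℤ.- (ℤ.+ (n * x))) (ℤ.+<+ (*-monoʳ-< 3 y<y′)))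

rank-< : ∀ {n} (col : Labeling n) {i i′ : Fin n} → col i ≡ col i′ → toℕ i < toℕ i′ → rank col i ℤ.< rank col i′
rank-< {n} col {i} {i′} same i<i′ =
  subst (λ c → rank col i ℤ.< cellRank n (toℕ c) (row col i′)) same
    (cellRank-monoʳ-< n (toℕ (col i)) (row-< col same i<i′))

rankAt-fromℕ< : ∀ {n} (col : Labeling n) {k} (k<n : k < n) → rankAt col k ≡ rank col (fromℕ< k<n)
rankAt-fromℕ< {n} col {k} k<n with k <? n
... | yes k<n′ = cong (rank col) (Fin.fromℕ<-cong k k refl k<n′ k<n)
... | no k≮n = contradiction k<n k≮n

sameColumn⇒∈ides : ∀ {n} (col : Labeling n) k → suc k < n → colAt col k ≡ colAt col (suc k) → suc k ∈ ides col
sameColumn⇒∈ides {suc n} col k (s≤s k<n) same =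
  ∈-map⁺ suc (∈-filter⁺ (λ k → rankAt col k ℤP.<? rankAt col (suc k)) (∈-upTo⁺ k<n) rank-increases)
  where
  k<1+n = m<n⇒m<1+n k<n
  rank-increases : rankAt col k ℤ.< rankAt col (suc k)
  rank-increases = subst₂ ℤ._<_ (sym (rankAt-fromℕ< col k<1+n)) (sym (rankAt-fromℕ< col (s≤s k<n)))
    (rank-< col (trans (sym (colAt-fromℕ< col k<1+n)) (trans same (colAt-fromℕ< col (s≤s k<n))))
      (subst₂ _<_ (sym (Fin.toℕ-fromℕ< k<1+n)) (sym (Fin.toℕ-fromℕ< (s≤s k<n))) (n<1+n k)))

-- Decoding pides π = 2^a1^b

∸≡suc⇒≡+ : ∀ {m p k} → m ∸ p ≡ suc k → m ≡ p + suc k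
∸≡suc⇒≡+ {m} {p} eq = trans (sym (m+[n∸m]≡n p≤m)) (cong (p +_) eq)
  where
  p≤m : p ≤ m
  p≤m = <⇒≤ (m∸n≢0⇒n<m (λ eq₀ → 0≢1+n (trans (sym eq₀) eq)))

diffs-ones⇒ : ∀ {n} b p I → diffs n p I ≡ replicate b 1 → n ≡ p + b × All (p <_) I
diffs-ones⇒ zero p [] ()
diffs-ones⇒ zero p (i ∷ I) ()
diffs-ones⇒ (suc zero) p [] eq = ∸≡suc⇒≡+ (∷-injectiveˡ eq) , []
diffs-ones⇒ (suc (suc b)) p [] eq with () ← ∷-injectiveʳ eq
diffs-ones⇒ {n} (suc b) p (i ∷ I) eq with ∷-injective eq
... | head , tail with i≡p+1 ← ∸≡suc⇒≡+ head | n≡i+b , i<I ← diffs-ones⇒ b i I tail =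
  trans n≡i+b (trans (cong (_+ b) i≡p+1) (+-assoc p 1 b)) , p<i ∷ All.map (<-trans p<i) i<I
  where
  p<i : p < i
  p<i = subst (p <_) (sym i≡p+1) (m<m+n p (s≤s z≤n))

diffs-comp21⇒ : ∀ {n} a b p I → diffs n p I ≡ comp21 a b →
  n ≡ p + (2 * a + b) × All (p <_) I × (∀ j → j < a → suc (p + 2 * j) ∉ I)
diffs-comp21⇒ zero b p I eq with n≡p+b , p<I ← diffs-ones⇒ b p I eq = n≡p+b , p<I , λ _ ()
diffs-comp21⇒ (suc zero) zero p [] eq = ∸≡suc⇒≡+ (∷-injectiveˡ eq) , [] , λ _ _ ()
diffs-comp21⇒ (suc zero) (suc b) p [] eq with () ← ∷-injectiveʳ eq
diffs-comp21⇒ (suc (suc a)) b p [] eq with () ← ∷-injectiveʳ eq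
diffs-comp21⇒ {n} (suc a) b p (i ∷ I) eq with ∷-injective eq
... | head , tail with i≡p+2 ← ∸≡suc⇒≡+ head | n≡i+m , i<I , odd∉I ← diffs-comp21⇒ a b i I tail =
  trans n≡i+m (trans (cong (_+ (2 * a + b)) i≡p+2) (length-step p a b)) ,
  p<i ∷ All.map (<-trans p<i) i<I ,
  odd∉i∷I
  where
  length-step : ∀ p a b → p + 2 + (2 * a + b) ≡ p + (2 * suc a + b)
  length-step = solve-∀
  odd-step : ∀ p j → suc (p + 2 * suc j) ≡ suc (p + 2 + 2 * j)
  odd-step = solve-∀
  odd-shift : ∀ j → suc (p + 2 * suc j) ≡ suc (i + 2 * j)
  odd-shift j = trans (odd-step p j) (cong (λ m → suc (m + 2 * j)) (sym i≡p+2))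
  p<i : p < i
  p<i = subst (p <_) (sym i≡p+2) (m<m+n p (s≤s z≤n))
  p+1<i : suc (p + 0) < i
  p+1<i = subst (_< i) (sym (cong suc (+-identityʳ p))) (subst (suc p <_) (sym i≡p+2) (≤-reflexive (+-comm 2 p)))
  odd∉i∷I : ∀ j → j < suc a → suc (p + 2 * j) ∉ i ∷ I
  odd∉i∷I zero _ (here p+1≡i) = <-irrefl p+1≡i p+1<i
  odd∉i∷I zero _ (there p+1∈I) = <-asym p+1<i (All.lookup i<I p+1∈I)
  odd∉i∷I (suc j) _ (here odd≡i) = <-irrefl (sym odd≡i) (subst (i <_) (sym (odd-shift j)) (s≤s (m≤m+n i (2 * j))))
  odd∉i∷I (suc j) (s≤s j<a) (there odd∈I) = odd∉I j j<a (subst (_∈ I) (odd-shift j) odd∈I)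

PairsInDistinctColumns : ∀ {n} → Labeling n → ℕ → Set
PairsInDistinctColumns col a = ∀ j → j < a → colAt col (2 * j) ≢ colAt col (suc (2 * j))

pides-comp21⇒ : ∀ {n} (col : Labeling n) a b → pides col ≡ comp21 a b →
  n ≡ 2 * a + b × PairsInDistinctColumns col a
pides-comp21⇒ {n} col a b eq with n≡2a+b , _ , odd∉ides ← diffs-comp21⇒ a b 0 (ides col) eq =
  n≡2a+b , λ j j<a same → odd∉ides j j<a (sameColumn⇒∈ides col (2 * j) (pair<n j<a) same)
  where
  pair<n : ∀ {j} → j < a → suc (2 * j) < n
  pair<n {j} j<a = subst (suc (2 * j) <_) (sym n≡2a+b)
    (≤-trans (≤-trans (≤-reflexive (sym (*-suc 2 j))) (*-monoʳ-≤ 2 j<a)) (m≤m+n (2 * a) b))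

pairCount : PType → Fin 3 → ℕ
pairCount t x = δ (pairFirst t) x + δ (pairSecond t) x

singleCount : PType → Fin 3 → ℕ
singleCount t x = δ (singleCol t) x

δ-pairType : ∀ {u v} → u ≢ v → ∀ x → δ u x + δ v x ≡ pairCount (pairType u v) x
δ-pairType {fz} {fz} u≢v x = contradiction refl u≢v
δ-pairType {fz} {fs fz} u≢v x = refl
δ-pairType {fz} {fs (fs fz)} u≢v x = refl
δ-pairType {fs fz} {fz} u≢v x = +-comm (δ c' x) (δ ℓ' x)
δ-pairType {fs fz} {fs fz} u≢v x = contradiction refl u≢v
δ-pairType {fs fz} {fs (fs fz)} u≢v x = refl
δ-pairType {fs (fs fz)} {fz} u≢v x = +-comm (δ r' x) (δ ℓ' x)
δ-pairType {fs (fs fz)} {fs fz} u≢v x = +-comm (δ r' x) (δ c' x)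
δ-pairType {fs (fs fz)} {fs (fs fz)} u≢v x = contradiction refl u≢v

δ-singleType : ∀ u x → δ u x ≡ singleCount (singleType u) x
δ-singleType fz x = refl
δ-singleType (fs fz) x = refl
δ-singleType (fs (fs fz)) x = refl

pairCount-ℓ : ∀ t → pairCount t ℓ' ≡ singleCount t ℓ' + singleCount t c'
pairCount-ℓ L = refl
pairCount-ℓ C = refl
pairCount-ℓ R = refl

pairCount-ℓc : ∀ t → pairCount t ℓ' + pairCount t c' ≡ suc (singleCount t ℓ')
pairCount-ℓc L = refl
pairCount-ℓc C = refl
pairCount-ℓc R = refl

pairsIn singlesIn : (ℕ → PType) → ℕ → ℕ → Fin 3 → ℕ
pairsIn p lo len x = sumFrom (λ m → pairCount (p m) x) lo len
singlesIn p lo len x = sumFrom (λ m → singleCount (p m) x) lo len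

pairs-singles-exchange : ∀ p lo len lo′ len′ →
  (pairsIn p lo len ℓ' + singlesIn p lo′ len′ ℓ') + (pairsIn p lo len c' + singlesIn p lo′ len′ c')
    ≡ (pairsIn p lo′ len′ ℓ' + singlesIn p lo len ℓ') + len
pairs-singles-exchange p lo len lo′ len′ = begin
  (Pℓ + Sℓ) + (Pc + Sc) ≡⟨ interchange Pℓ Sℓ Pc Sc ⟩
  (Pℓ + Pc) + (Sℓ + Sc) ≡⟨ cong₂ _+_ pairs-ℓc singles-ℓc ⟩
  (Tℓ + len) + Qℓ       ≡⟨ rearrange Tℓ len Qℓ ⟩
  (Qℓ + Tℓ) + len       ∎
  where
  open ≡-Reasoning
  Pℓ = pairsIn p lo len ℓ'
  Pc = pairsIn p lo len c'
  Tℓ = singlesIn p lo len ℓ'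
  Qℓ = pairsIn p lo′ len′ ℓ'
  Sℓ = singlesIn p lo′ len′ ℓ'
  Sc = singlesIn p lo′ len′ c'
  interchange : ∀ w x y z → (w + x) + (y + z) ≡ (w + y) + (x + z)
  interchange = solve-∀
  rearrange : ∀ x y z → (x + y) + z ≡ (z + x) + y
  rearrange = solve-∀
  pairs-ℓc : Pℓ + Pc ≡ Tℓ + len
  pairs-ℓc = trans (sym (sumFrom-+ _ _ lo len))
    (trans (sumFrom-cong lo len (λ m _ → pairCount-ℓc (p m))) (sumFrom-suc _ lo len))
  singles-ℓc : Sℓ + Sc ≡ Qℓ
  singles-ℓc = trans (sym (sumFrom-+ _ _ lo′ len′)) (sumFrom-cong lo′ len′ (λ m _ → sym (pairCount-ℓ (p m))))

-- Column heights of π and 𝕊(π)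

ptype-pair : ∀ {n} (col : Labeling n) a {j} → j < a →
  ptype col a (suc j) ≡ pairType (colAt col (2 * j)) (colAt col (suc (2 * j)))
ptype-pair col a {j} j<a with suc j ≤? a
... | yes _ = cong₂ pairType (cong (λ m → colOf col (m ∸ 1)) (*-suc 2 j)) (cong (colOf col) (*-suc 2 j))
... | no j≮a = contradiction j<a j≮a

ptype-single : ∀ {n} (col : Labeling n) a s → ptype col a (suc (a + s)) ≡ singleType (colAt col (2 * a + s))
ptype-single col a s with suc (a + s) ≤? a
... | yes a+s<a = contradiction a+s<a (<⇒≱ (s≤s (m≤m+n a s)))
... | no _ = cong (singleType ∘ colOf col) (begin
  2 * a + (suc (a + s) ∸ a) ≡⟨ cong (λ m → 2 * a + (m ∸ a)) (+-suc a s) ⟨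
  2 * a + (a + suc s ∸ a)   ≡⟨ cong (2 * a +_) (m+n∸m≡n a (suc s)) ⟩
  2 * a + suc s             ≡⟨ +-suc (2 * a) s ⟩
  suc (2 * a + s)           ∎)
  where open ≡-Reasoning

height≡pairs+singles : ∀ {n} (col : Labeling n) a b → n ≡ 2 * a + b →
  PairsInDistinctColumns col a →
  ∀ x → height col x ≡ pairsIn (ptype col a) 1 a x + singlesIn (ptype col a) (suc a) b x
height≡pairs+singles {n} col a b refl distinct x = begin
  height col x
    ≡⟨ height-sumFrom col (colAt col) (colAt-toℕ col) x ⟩
  sumFrom cars 0 (2 * a + b)
    ≡⟨ sumFrom-split cars 0 (2 * a) b ⟩
  sumFrom cars 0 (2 * a) + sumFrom cars (2 * a) b
    ≡⟨ cong₂ _+_ (sumFrom-pairs cars 0 a) (sumFrom-offset cars (2 * a) b) ⟩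
  sumFrom (λ j → cars (2 * j) + cars (suc (2 * j))) 0 a + sumFrom (λ s → cars (2 * a + s)) 0 b
    ≡⟨ cong₂ _+_ (sumFrom-cong 0 a pair) (sumFrom-cong 0 b single) ⟩
  sumFrom (λ j → pairCount (p (suc j)) x) 0 a + sumFrom (λ s → singleCount (p (suc a + s)) x) 0 b
    ≡⟨ cong₂ _+_ (sumFrom-offset (λ m → pairCount (p m) x) 1 a) (sumFrom-offset (λ m → singleCount (p m) x) (suc a) b) ⟨
  pairsIn p 1 a x + singlesIn p (suc a) b x ∎
  where
  open ≡-Reasoning
  p = ptype col a
  cars : ℕ → ℕ
  cars k = δ (colAt col k) x
  pair : ∀ j → j < a → cars (2 * j) + cars (suc (2 * j)) ≡ pairCount (p (suc j)) x
  pair j j<a = trans (δ-pairType (distinct j j<a) x) (cong (λ t → pairCount t x) (sym (ptype-pair col a j<a)))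
  single : ∀ s → s < b → cars (2 * a + s) ≡ singleCount (p (suc a + s)) x
  single s _ = trans (δ-singleType (colAt col (2 * a + s)) x) (cong (λ t → singleCount t x) (sym (ptype-single col a s)))

-- switch indexed by ℕ, so that its cases can be unfolded at 2j, 2j + 1 and 2b + s.
switchAt : ∀ {n} → Labeling n → (a b : ℕ) → ℕ → Fin 3
switchAt col a b k with k <? 2 * b
... | yes _ with k % 2
...   | 0 = pairFirst  (ptype col a (a + b + 1 ∸ (k / 2 + 1)))
...   | _ = pairSecond (ptype col a (a + b + 1 ∸ (k / 2 + 1)))
switchAt col a b k | no _ = singleCol (ptype col a (a + b + 1 ∸ (b + (k ∸ 2 * b) + 1)))

switch-toℕ : ∀ {n} (col : Labeling n) a b (i : Fin (a + 2 * b)) → switchAt col a b (toℕ i) ≡ switch col a b i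
switch-toℕ col a b i with toℕ i <? 2 * b
... | yes _ with toℕ i % 2
...   | 0 = refl
...   | suc _ = refl
switch-toℕ col a b i | no _ = refl

[r+2j]%2≡r : ∀ {r} j → r < 2 → (r + 2 * j) % 2 ≡ r
[r+2j]%2≡r {r} j r<2 =
  trans (cong (λ m → (r + m) % 2) (*-comm 2 j)) (trans ([m+kn]%n≡m%n r j 2) (m<n⇒m%n≡m r<2))

[r+2j]/2≡j : ∀ {r} j → r < 2 → (r + 2 * j) / 2 ≡ j
[r+2j]/2≡j {r} j r<2 = begin
  (r + 2 * j) / 2   ≡⟨ +-distrib-/-∣ʳ r (m∣m*n j) ⟩
  r / 2 + 2 * j / 2 ≡⟨ cong₂ _+_ (m<n⇒m/n≡0 r<2) (cong (_/ 2) (*-comm 2 j)) ⟩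
  j * 2 / 2         ≡⟨ m*n/n≡m j 2 ⟩
  j                 ∎
  where open ≡-Reasoning

[m+1]∸[n+1]≡m∸n : ∀ m n → m + 1 ∸ (n + 1) ≡ m ∸ n
[m+1]∸[n+1]≡m∸n m n = cong₂ _∸_ (+-comm m 1) (+-comm n 1)

switchAt-pairFirst : ∀ {n} (col : Labeling n) a b {j} → j < b →
  switchAt col a b (2 * j) ≡ pairFirst (ptype col a (a + b ∸ j))
switchAt-pairFirst col a b {j} j<b with 2 * j <? 2 * b
... | no 2j≮2b = contradiction (*-monoʳ-< 2 j<b) 2j≮2b
... | yes _ rewrite [r+2j]%2≡r j (s≤s z≤n) | [r+2j]/2≡j j (s≤s z≤n) =
  cong (pairFirst ∘ ptype col a) ([m+1]∸[n+1]≡m∸n (a + b) j)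

switchAt-pairSecond : ∀ {n} (col : Labeling n) a b {j} → j < b →
  switchAt col a b (suc (2 * j)) ≡ pairSecond (ptype col a (a + b ∸ j))
switchAt-pairSecond col a b {j} j<b with suc (2 * j) <? 2 * b
... | no 2j+1≮2b = contradiction (≤-trans (≤-reflexive (sym (*-suc 2 j))) (*-monoʳ-≤ 2 j<b)) 2j+1≮2b
... | yes _ rewrite [r+2j]%2≡r j (s≤s (s≤s z≤n)) | [r+2j]/2≡j j (s≤s (s≤s z≤n)) =
  cong (pairSecond ∘ ptype col a) ([m+1]∸[n+1]≡m∸n (a + b) j)

switchAt-single : ∀ {n} (col : Labeling n) a b s → switchAt col a b (2 * b + s) ≡ singleCol (ptype col a (a ∸ s))
switchAt-single col a b s with 2 * b + s <? 2 * b
... | yes 2b+s<2b = contradiction (m≤m+n (2 * b) s) (<⇒≱ 2b+s<2b)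
... | no _ = cong (singleCol ∘ ptype col a) (begin
  a + b + 1 ∸ (b + (2 * b + s ∸ 2 * b) + 1) ≡⟨ cong (λ m → a + b + 1 ∸ (b + m + 1)) (m+n∸m≡n (2 * b) s) ⟩
  a + b + 1 ∸ (b + s + 1)                   ≡⟨ cong₂ _∸_ (+-rotate a b) (trans (cong (_+ 1) (+-comm b s)) (+-rotate s b)) ⟩
  (b + 1) + a ∸ ((b + 1) + s)               ≡⟨ [m+n]∸[m+o]≡n∸o (b + 1) a s ⟩
  a ∸ s                                     ∎)
  where
  open ≡-Reasoning
  +-rotate : ∀ x b → x + b + 1 ≡ b + 1 + x
  +-rotate = solve-∀

height-switch≡pairs+singles : ∀ {n} (col : Labeling n) a b x →
  height (switch col a b) x ≡ pairsIn (ptype col a) (suc a) b x + singlesIn (ptype col a) 1 a x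
height-switch≡pairs+singles col a b x = begin
  height (switch col a b) x
    ≡⟨ height-sumFrom (switch col a b) (switchAt col a b) (switch-toℕ col a b) x ⟩
  sumFrom cars 0 (a + 2 * b)
    ≡⟨ cong (sumFrom cars 0) (+-comm a (2 * b)) ⟩
  sumFrom cars 0 (2 * b + a)
    ≡⟨ sumFrom-split cars 0 (2 * b) a ⟩
  sumFrom cars 0 (2 * b) + sumFrom cars (2 * b) a
    ≡⟨ cong₂ _+_ (sumFrom-pairs cars 0 b) (sumFrom-offset cars (2 * b) a) ⟩
  sumFrom (λ j → cars (2 * j) + cars (suc (2 * j))) 0 b + sumFrom (λ s → cars (2 * b + s)) 0 a
    ≡⟨ cong₂ _+_ (sumFrom-cong 0 b pair) (sumFrom-cong 0 a single) ⟩
  sumFrom (λ j → pairCount (p (a + b ∸ j)) x) 0 b + sumFrom (λ s → singleCount (p (a ∸ s)) x) 0 a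
    ≡⟨ cong₂ _+_ (sumFrom-reverse (λ m → pairCount (p m) x) a b) (sumFrom-reverse (λ m → singleCount (p m) x) 0 a) ⟩
  pairsIn p (suc a) b x + singlesIn p 1 a x ∎
  where
  open ≡-Reasoning
  p = ptype col a
  cars : ℕ → ℕ
  cars k = δ (switchAt col a b k) x
  pair : ∀ j → j < b → cars (2 * j) + cars (suc (2 * j)) ≡ pairCount (p (a + b ∸ j)) x
  pair j j<b = cong₂ (λ u v → δ u x + δ v x) (switchAt-pairFirst col a b j<b) (switchAt-pairSecond col a b j<b)
  single : ∀ s → s < a → cars (2 * b + s) ≡ singleCount (p (a ∸ s)) x
  single s _ = cong (λ u → δ u x) (switchAt-single col a b s)

topFull-switch : ∀ {n} (col : Labeling n) a b → n ≡ 2 * a + b →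
  PairsInDistinctColumns col a →
  topFull col c' ≡ topFull (switch col a b) ℓ' + a × topFull (switch col a b) c' ≡ topFull col ℓ' + b
topFull-switch col a b n≡2a+b distinct =
  trans (cong₂ _+_ (before ℓ') (before c')) (trans (pairs-singles-exchange p 1 a (suc a) b) (cong (_+ a) (sym (after ℓ')))) ,
  trans (cong₂ _+_ (after ℓ') (after c')) (trans (pairs-singles-exchange p (suc a) b 1 a) (cong (_+ b) (sym (before ℓ'))))
  where
  p = ptype col a
  before = height≡pairs+singles col a b n≡2a+b distinct
  after = height-switch≡pairs+singles col a b

theorem13 : (n : ℕ) → 0 < n → (π : Labeling n) → IsParkingFunction n π →
    (a b : ℕ) → pides π ≡ comp21 a b →
    area n π ≡ area (a + 2 * b) (switch π a b)
theorem13 n _ π _ a b pides≡2ᵃ1ᵇ with pides-comp21⇒ π a b pides≡2ᵃ1ᵇ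
... | n≡2a+b , distinct with topFull-switch π a b n≡2a+b distinct
... | H₁≡H₀′+a , H₁′≡H₀+b = begin
  area n π                          ≡⟨ area-twoColumns π ⟩
  areaCol n 0 H₀ + areaCol n 1 H₁   ≡⟨ cong₂ _+_ (areaCol-shift n 0 H₀ N 1 H₁′ left↔middle) (areaCol-shift n 1 H₁ N 0 H₀′ middle↔left) ⟩
  areaCol N 1 H₁′ + areaCol N 0 H₀′ ≡⟨ +-comm (areaCol N 1 H₁′) _ ⟩
  areaCol N 0 H₀′ + areaCol N 1 H₁′ ≡⟨ area-twoColumns S ⟨
  area N S                          ∎
  where
  open ≡-Reasoning
  N = a + 2 * b
  S = switch π a b
  H₀ = topFull π ℓ'
  H₁ = topFull π c'
  H₀′ = topFull S ℓ'
  H₁′ = topFull S c'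
  identity₀ : ∀ h a b → 3 * h + (a + 2 * b) * 2 ≡ 3 * (h + b) + (2 * a + b) * 1
  identity₀ = solve-∀
  identity₁ : ∀ h a b → 3 * (h + a) + (a + 2 * b) * 1 ≡ 3 * h + (2 * a + b) * 2
  identity₁ = solve-∀
  left↔middle : 3 * H₀ + N * 2 ≡ 3 * H₁′ + n * 1
  left↔middle = trans (identity₀ H₀ a b) (cong₂ (λ h m → 3 * h + m * 1) (sym H₁′≡H₀+b) (sym n≡2a+b))
  middle↔left : 3 * H₁ + N * 1 ≡ 3 * H₀′ + n * 2
  middle↔left = trans (cong (λ h → 3 * h + N * 1) H₁≡H₀′+a)
    (trans (identity₁ H₀′ a b) (cong (λ m → 3 * H₀′ + m * 2) (sym n≡2a+b)))
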